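{- For integers $n\ge m\ge 8$, the torus $C_n\square C_m$ satisfies (i) $c^{0}(C_n\square C_m)=5$, $c^{1}(C_n\square C_m)=8$, $c^{2}(C_n\square C_m)=12$; and (ii) $c^{3}(C_n\square C_m)\le 4m$.
   Context: $C_n$ is the cycle on $n$ vertices and $\square$ the Cartesian product: $(u,v)\sim(u',v')$ iff ($u=u'$ and $vv'$ is an edge of the second factor) or ($v=v'$ and $uu'$ is an edge of the first factor). For a graph $\Gamma$ and integer $g\ge0$, a set $X\subseteq V(\Gamma)$ is a $g$-good-neighbor cut if $\Gamma-X$ is disconnected and every vertex outside $X$ has at least $g$ neighbors outside $X$. For such $X$ and a component $C$ of $\Gamma-X$, $C$ is splittable if $V(C)$ partitions into nonempty $A,B$ with $\delta(\Gamma[A]),\delta(\Gamma[B])\ge g$; among such partitions with $|A|\ge|B|$ minimizing $|A|-|B|$ set $a(C)=|A|$. $a(X)=\min a(C)$ over splittable components, $c(X)=$ minimum order of a non-splittable component (minima over empty sets $+\infty$), and the gc number is $c^g(\Gamma)=\min_X\{|X|+\min\{a(X),c(X)\}\}$ over all $g$-good-neighbor cuts $X$. -}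

module Defs where

open import Data.Nat using (ℕ; zero; suc; _+_; _*_; _∸_; _≤_; _≥_)
open import Data.Nat.Properties using (_≟_)
open import Data.Fin using (Fin; toℕ)
open import Data.Bool using (Bool; true; false; _∧_; _∨_; not)
open import Data.List using (List; length; filterᵇ; cartesianProduct; allFin)
open import Data.Product using (_×_; _,_; Σ; ∃; ∃-syntax)
open import Data.Sum using (_⊎_)
open import Relation.Nullary using (¬_; ⌊_⌋)
open import Relation.Binary.PropositionalEquality using (_≡_)

-- A finite simple graph: vertex type, a list enumerating every vertex exactly once,
-- and a Boolean adjacency relation.
record FinGraph : Set₁ where
  field
    V     : Set
    verts : List V
    adj   : V → V → Bool

cycAdj : (n : ℕ) → Fin n → Fin n → Bool
cycAdj n i j =
     ⌊ toℕ j ≟ suc (toℕ i) ⌋ ∨ ⌊ toℕ i ≟ suc (toℕ j) ⌋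
  ∨ (⌊ suc (toℕ i) ≟ n ⌋ ∧ ⌊ toℕ j ≟ 0 ⌋)
  ∨ (⌊ suc (toℕ j) ≟ n ⌋ ∧ ⌊ toℕ i ≟ 0 ⌋)

torus : ℕ → ℕ → FinGraph
torus n m = record
  { V     = Fin n × Fin m
  ; verts = cartesianProduct (allFin n) (allFin m)
  ; adj   = λ { (u , v) (u' , v') →
                (⌊ toℕ u ≟ toℕ u' ⌋ ∧ cycAdj m v v')
              ∨ (⌊ toℕ v ≟ toℕ v' ⌋ ∧ cycAdj n u u') }
  }

module _ (Γ : FinGraph) where
  open FinGraph Γ

  VSet : Set
  VSet = V → Bool

  ∣_∣ₛ : VSet → ℕ
  ∣ S ∣ₛ = length (filterᵇ S verts)

  compl : VSet → VSet
  compl S v = not (S v)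

  degIn : VSet → V → ℕ
  degIn S v = length (filterᵇ (λ w → adj v w ∧ S w) verts)

  MinDegGe : VSet → ℕ → Set
  MinDegGe S g = ∀ v → S v ≡ true → degIn S v ≥ g

  NonEmpty : VSet → Set
  NonEmpty S = ∃[ v ] S v ≡ true

  data Reach (S : VSet) (u : V) : V → Set where
    here : S u ≡ true → Reach S u u
    step : ∀ {v w} → Reach S u v → adj v w ≡ true → S w ≡ true → Reach S u w

  Disconnected : VSet → Set
  Disconnected X = ∃[ u ] ∃[ v ]
    (X u ≡ false × X v ≡ false × ¬ Reach (compl X) u v)

  GoodNeighborCut : ℕ → VSet → Set
  GoodNeighborCut g X = Disconnected X × MinDegGe (compl X) g

  Component : VSet → VSet → Set
  Component X C = NonEmpty C × (∀ v → C v ≡ true → X v ≡ false)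
    × (∀ u v → C u ≡ true → X v ≡ false → (C v ≡ true → Reach (compl X) u v)
                                           × (Reach (compl X) u v → C v ≡ true))

  GoodSplit : ℕ → VSet → VSet → VSet → Set
  GoodSplit g C A B = NonEmpty A × NonEmpty B
    × (∀ v → C v ≡ (A v ∨ B v)) × (∀ v → (A v ∧ B v) ≡ false)
    × MinDegGe A g × MinDegGe B g

  Splittable : ℕ → VSet → Set
  Splittable g C = ∃[ A ] ∃[ B ] GoodSplit g C A B

  IsA : ℕ → VSet → ℕ → Set
  IsA g C k = ∃[ A ] ∃[ B ] (GoodSplit g C A B × ∣ A ∣ₛ ≥ ∣ B ∣ₛ × ∣ A ∣ₛ ≡ k
    × (∀ A' B' → GoodSplit g C A' B' → ∣ A' ∣ₛ ≥ ∣ B' ∣ₛ →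
         ∣ A' ∣ₛ ∸ ∣ B' ∣ₛ ≥ ∣ A ∣ₛ ∸ ∣ B ∣ₛ))

  -- contribution t of component C to min{a(X), c(X)}:
  -- a(C) if C is splittable, |C| otherwise
  CompVal : ℕ → VSet → ℕ → Set
  CompVal g C t = (Splittable g C × IsA g C t) ⊎ (¬ Splittable g C × t ≡ ∣ C ∣ₛ)

  -- |X| + min{a(X), c(X)} can equal / is attained by value k
  -- (the min over all components of their contribution; finite since Γ − X is disconnected)
  Attains : ℕ → VSet → ℕ → Set
  Attains g X k = ∃[ C ] ∃[ t ] (Component X C × CompVal g C t × ∣ X ∣ₛ + t ≡ k)

  GcEq : ℕ → ℕ → Set
  GcEq g k = (∃[ X ] (GoodNeighborCut g X × Attains g X k))
    × (∀ X C t → GoodNeighborCut g X → Component X C → CompVal g C t → k ≤ ∣ X ∣ₛ + t)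

  -- c^g(Γ) ≤ k  (in particular c^g(Γ) is finite)
  GcLe : ℕ → ℕ → Set
  GcLe g k = ∃[ X ] ∃[ k' ] (GoodNeighborCut g X × Attains g X k' × k' ≤ k)

-- If |X| < 8 ≤ m ≤ n, some column c₀ and some row r₀ of the torus avoid X, and together they lie in one
-- component of Γ − X.  Any other component D lives in the grid left after deleting column c₀ and row r₀,
-- where the positions along the two cycles, counted from c₀ and r₀, are honest integer coordinates.
-- Walking from a vertex of D in each of the four directions one hits X, at vertices told apart by their
-- coordinates: |X| ≥ 4, and |X| ≥ 6 as soon as a vertex of D has a neighbour in D.  For minimum degree 2,
-- the top and the bottom row of D each contain two adjacent vertices whose vertical neighbours outside D
-- lie in X; with the horizontal blockers of these rows this gives |X| ≥ 8 (a one-row D would have a vertex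
-- of degree ≤ 1).  The torus is triangle-free, so a part of minimum degree 0, 1, 2 has at least 1, 2, 4
-- vertices; hence the lower bounds 5, 8, 12, attained by the cuts around a 1×1, 2×1 and 2×2 block.  For
-- g = 3, columns 1 and 4 cut off columns 2 and 3, which induce a connected 3-regular graph that cannot be split.

module Submission where

open import Defs
open import Data.Bool as Bool using (Bool; true; false; _∧_; _∨_; not; T)
open import Data.Bool.Properties using (T-≡; ∨-assoc; ∨-comm; ∧-identityʳ; ∧-zeroʳ; ¬-not)
open import Data.Empty using (⊥; ⊥-elim)
open import Data.Fin as Fin using (Fin; zero; suc; toℕ; fromℕ; inject₁; lower₁; _↑ˡ_; _↑ʳ_; splitAt; join; #_)
open import Data.Fin.Properties as Fin
  using (all?; any?; ¬∀⟶∃¬; join-splitAt; toℕ-injective; toℕ-lower₁; toℕ-fromℕ; toℕ-inject₁; toℕ≤pred[n])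
open import Data.List using (List; []; _∷_; length; filterᵇ; tabulate; _++_)
open import Data.List.Membership.Propositional using (_∈_)
open import Data.List.Membership.Propositional.Properties
  using (∈-filter⁺; ∈-filter⁻; ∈-cartesianProduct⁺; ∈-allFin; ∈-++⁺ˡ; ∈-++⁺ʳ; ∈-tabulate⁺)
open import Data.List.Properties using (length-++; length-tabulate)
open import Data.List.Relation.Binary.Subset.Propositional using (_⊆_)
open import Data.List.Relation.Unary.All as All using (All; []; _∷_)
import Data.List.Relation.Unary.All.Properties as All
open import Data.List.Relation.Unary.AllPairs as AllPairs using ([]; _∷_)
open import Data.List.Relation.Unary.Any using (here; there)
open import Data.List.Relation.Unary.Linked using (Linked; []; [-]; _∷_)
open import Data.List.Relation.Unary.Linked.Properties using (Linked⇒AllPairs)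
open import Data.List.Relation.Unary.Unique.Propositional using (Unique)
import Data.List.Relation.Unary.Unique.Propositional.Properties as Unique
open import Data.Nat using (ℕ; zero; suc; _+_; _*_; _∸_; _≤_; _<_; z≤n; s≤s; _<?_; _≤?_; _≤ᵇ_)
open import Data.Nat.Induction using (<-rec; <-wellFounded)
open import Data.Nat.Properties
  using (_≟_; ≤-refl; ≤-trans; ≤-reflexive; ≤-antisym; ≤-pred; <-irrefl; <-trans; <-≤-trans; <⇒≤; ≤⇒≯; ≰⇒>; ≮⇒≥;
         ≤∧≢⇒<; m≤n⇒m<n∨m≡n; 0≢1+n; n≮0; n≤1+n; n<1+n; m≤m+n; m≤n+m; m<m+n; suc-injective; ≤ᵇ⇒≤;
         +-suc; +-assoc; +-identityʳ; +-cancelˡ-≡; +-mono-≤; +-monoʳ-<; +-monoˡ-<; ∸-monoʳ-<; m∸n≤m; m+[n∸m]≡n;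
         +-∸-assoc; +-monoʳ-≤; m≤n⇒∃[o]m+o≡n; <-isStrictPartialOrder)
open import Data.Product using (_×_; _,_; proj₁; proj₂; ∃-syntax)
open import Data.Product.Properties using (≡-dec)
open import Data.Product.Relation.Binary.Lex.Strict using (×-Lex; ×-isStrictPartialOrder)
open import Data.Product.Relation.Binary.Pointwise.NonDependent using (≡⇒≡×≡)
open import Data.Sum using (_⊎_; inj₁; inj₂)
open import Function using (_∘_; case_of_; Equivalence)
open import Induction.WellFounded using (Acc; acc)
open import Relation.Binary.Definitions using (DecidableEquality)
open import Relation.Binary.PropositionalEquality
  using (_≡_; _≢_; refl; sym; trans; cong; cong₂; subst; subst₂; module ≡-Reasoning)
open import Relation.Binary.Structures using (IsStrictPartialOrder)
open import Relation.Nullary using (¬_; Dec; yes; no; ⌊_⌋; ¬?; _×-dec_)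
open import Relation.Nullary.Decidable using (True; T?; toWitness; fromWitness; decidable-stable)


private
  variable
    a b : Bool

∧-true⁻ : a ∧ b ≡ true → a ≡ true × b ≡ true
∧-true⁻ {true} {true} _ = refl , refl

∧-true⁺ : a ≡ true → b ≡ true → a ∧ b ≡ true
∧-true⁺ refl refl = refl

∨-true⁻ : a ∨ b ≡ true → a ≡ true ⊎ b ≡ true
∨-true⁻ {true}  _ = inj₁ refl
∨-true⁻ {false} e = inj₂ e

not-true⁻ : not a ≡ true → a ≡ false
not-true⁻ {false} _ = refl

not-true⁺ : a ≡ false → not a ≡ true
not-true⁺ refl = refl

true≢false : a ≡ true → a ≡ false → ⊥
true≢false refl ()

∨-trueˡ : a ≡ true → a ∨ b ≡ true
∨-trueˡ refl = refl

∨-trueʳ : b ≡ true → a ∨ b ≡ true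
∨-trueʳ {a = true}  _ = refl
∨-trueʳ {a = false} e = e

∨-swap : ∀ a b c d → a ∨ b ∨ c ∨ d ≡ b ∨ a ∨ d ∨ c
∨-swap a b c d = begin
  a ∨ (b ∨ (c ∨ d))   ≡⟨ ∨-assoc a b _ ⟨
  (a ∨ b) ∨ (c ∨ d)   ≡⟨ cong₂ _∨_ (∨-comm a b) (∨-comm c d) ⟩
  (b ∨ a) ∨ (d ∨ c)   ≡⟨ ∨-assoc b a _ ⟩
  b ∨ (a ∨ (d ∨ c))   ∎
  where open ≡-Reasoning

⌊⌋-sound : ∀ {A : Set} (a? : Dec A) → ⌊ a? ⌋ ≡ true → A
⌊⌋-sound a? = toWitness ∘ Equivalence.from T-≡

⌊⌋-complete : ∀ {A : Set} (a? : Dec A) → A → ⌊ a? ⌋ ≡ true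
⌊⌋-complete a? = Equivalence.to T-≡ ∘ fromWitness

≟-sound : ∀ {m n : ℕ} → ⌊ m ≟ n ⌋ ≡ true → m ≡ n
≟-sound {m} {n} = ⌊⌋-sound (m ≟ n)

≟-complete : ∀ {m n : ℕ} → m ≡ n → ⌊ m ≟ n ⌋ ≡ true
≟-complete {m} {n} = ⌊⌋-complete (m ≟ n)

∨-resolve : ∀ {a b} → T (a ∨ b) → a ≡ false → T b
∨-resolve t refl = t

module _ {A : Set} where

  private
    variable
      x y : A
      xs ys : List A

  delete : x ∈ xs → List A
  delete {xs = _ ∷ zs} (here _)  = zs
  delete {xs = z ∷ _}  (there p) = z ∷ delete p

  length-delete : (p : x ∈ xs) → length xs ≡ suc (length (delete p))
  length-delete (here _)  = refl
  length-delete (there p) = cong suc (length-delete p)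

  ∈-delete : (p : x ∈ xs) → y ∈ xs → y ≢ x → y ∈ delete p
  ∈-delete (here refl) (here refl) y≢x = ⊥-elim (y≢x refl)
  ∈-delete (here _)    (there q)   _   = q
  ∈-delete (there _)   (here refl) _   = here refl
  ∈-delete (there p)   (there q)   y≢x = there (∈-delete p q y≢x)

  Unique⇒length≤ : Unique xs → xs ⊆ ys → length xs ≤ length ys
  Unique⇒length≤ {xs = []}    _                 _   = z≤n
  Unique⇒length≤ {xs = x ∷ xs} (x∉xs ∷ unique) xs⊆ys =
    ≤-trans (s≤s (Unique⇒length≤ unique xs⊆delete)) (≤-reflexive (sym (length-delete x∈ys)))
    where
    x∈ys = xs⊆ys (here refl)
    xs⊆delete : xs ⊆ delete x∈ys
    xs⊆delete {z} z∈xs = ∈-delete x∈ys (xs⊆ys (there z∈xs)) (distinct x∉xs z∈xs)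
      where
      distinct : ∀ {zs} → All (x ≢_) zs → z ∈ zs → z ≢ x
      distinct (x≢z ∷ _)  (here refl) = x≢z ∘ sym
      distinct (_ ∷ x≢zs) (there q)   = distinct x≢zs q

  length≥1⇒member : 1 ≤ length xs → ∃[ x ] x ∈ xs
  length≥1⇒member {xs = x ∷ _} _ = x , here refl

  length≥2⇒members : Unique xs → 2 ≤ length xs → ∃[ x ] ∃[ y ] x ≢ y × x ∈ xs × y ∈ xs
  length≥2⇒members {xs = x ∷ y ∷ _} ((x≢y ∷ _) ∷ _) _ = x , y , x≢y , here refl , there (here refl)
  length≥2⇒members {xs = _ ∷ []} _ (s≤s ())

  _≺[_]_ : A → (A → ℕ × ℕ) → A → Set
  x ≺[ key ] y = ×-Lex _≡_ _<_ _<_ (key x) (key y)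

  Linked≺⇒Unique : (key : A → ℕ × ℕ) → Linked _≺[ key ]_ xs → Unique xs
  Linked≺⇒Unique key =
    AllPairs.map (λ x≺y x≡y → Lex.irrefl (≡⇒≡×≡ (cong key x≡y)) x≺y) ∘ Linked⇒AllPairs Lex.trans
    where module Lex = IsStrictPartialOrder (×-isStrictPartialOrder <-isStrictPartialOrder <-isStrictPartialOrder)

  module _ (p : A → Bool) where

    ∈-filterᵇ⁺ : x ∈ xs → p x ≡ true → x ∈ filterᵇ p xs
    ∈-filterᵇ⁺ x∈xs px = ∈-filter⁺ (T? ∘ p) x∈xs (Equivalence.from T-≡ px)

    ∈-filterᵇ⁻ : ∀ xs → x ∈ filterᵇ p xs → x ∈ xs × p x ≡ true
    ∈-filterᵇ⁻ _ x∈ with x∈xs , px ← ∈-filter⁻ (T? ∘ p) x∈ = x∈xs , Equivalence.to T-≡ px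

    Unique-filterᵇ : Unique xs → Unique (filterᵇ p xs)
    Unique-filterᵇ = Unique.filter⁺ (T? ∘ p)

  length-filterᵇ-partition : (r p q : A → Bool) → (∀ x → r x ≡ (p x ∨ q x)) → (∀ x → (p x ∧ q x) ≡ false) →
    ∀ xs → length (filterᵇ r xs) ≡ length (filterᵇ p xs) + length (filterᵇ q xs)
  length-filterᵇ-partition r p q cover disjoint [] = refl
  length-filterᵇ-partition r p q cover disjoint (x ∷ xs)
    with ih ← length-filterᵇ-partition r p q cover disjoint xs
    | r x | p x | q x | cover x | disjoint x
  ... | true  | true  | false | _ | _ = cong suc ih
  ... | true  | false | true  | _ | _ = trans (cong suc ih) (sym (+-suc _ _))
  ... | false | false | false | _ | _ = ih

module _ {P : ℕ → Set} where

  ¬¬-least : ∀ {k} → P k → ¬ ¬ (∃[ t ] P t × (∀ {j} → j < t → ¬ P j))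
  ¬¬-least {k} Pk no-least = <-rec (λ t → ¬ P t) (λ t below-fail Pt → no-least (t , Pt , below-fail)) k Pk

  ¬¬-greatest : ∀ bound → (∀ {j} → P j → j ≤ bound) → ∀ {k} → P k → ¬ ¬ (∃[ b ] P b × (∀ {j} → b < j → ¬ P j))
  ¬¬-greatest bound bounded {k} Pk no-greatest = <-rec Q fails (bound ∸ k) k refl Pk
    where
    Q : ℕ → Set
    Q d = ∀ j → bound ∸ j ≡ d → ¬ P j
    fails : ∀ d → (∀ {d′} → d′ < d → Q d′) → Q d
    fails _ above-fail j refl Pj =
      no-greatest (j , Pj , λ {i} j<i Pi → above-fail (∸-monoʳ-< j<i (bounded Pi)) i refl Pi)

module Graph (Γ : FinGraph) where
  open FinGraph Γ

  private
    variable
      S X C : VSet Γ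
      u v : V
      g k t : ℕ

  Symmetric : Set
  Symmetric = ∀ u v → adj u v ≡ true → adj v u ≡ true

  Loopless : Set
  Loopless = ∀ v → adj v v ≢ true

  TriangleFree : Set
  TriangleFree = ∀ x y z → adj x y ≡ true → adj x z ≡ true → adj y z ≡ true → ⊥

  adj⇒≢ : Loopless → adj u v ≡ true → u ≢ v
  adj⇒≢ {u} loopless e refl = loopless u e

  Reach-end : Reach Γ S u v → S v ≡ true
  Reach-end (here Sv)     = Sv
  Reach-end (step _ _ Sv) = Sv

  Reach-trans : ∀ {w} → Reach Γ S u v → Reach Γ S v w → Reach Γ S u w
  Reach-trans r (here _)      = r
  Reach-trans r (step r′ a s) = step (Reach-trans r r′) a s

  Reach-sym : Symmetric → Reach Γ S u v → Reach Γ S v u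
  Reach-sym sym-adj (here Su)      = here Su
  Reach-sym sym-adj (step {v} {w} r a Sw) =
    Reach-trans (step (here Sw) (sym-adj v w a) (Reach-end r)) (Reach-sym sym-adj r)

  Reach-preserves : (P : VSet Γ) → (∀ {y z} → P y ≡ true → adj y z ≡ true → S z ≡ true → P z ≡ true) →
                    P u ≡ true → Reach Γ S u v → P v ≡ true
  Reach-preserves P closed Pu (here _)      = Pu
  Reach-preserves P closed Pu (step r a Sz) = closed (Reach-preserves P closed Pu r) a Sz

  Closed : VSet Γ → VSet Γ → Set
  Closed X C = ∀ u v → C u ≡ true → adj u v ≡ true → X v ≡ false → C v ≡ true

  Reach-Closed : Closed X C → C u ≡ true → Reach Γ (compl Γ X) u v → C v ≡ true
  Reach-Closed {X} {C} closed = Reach-preserves C (λ {y} {z} Cy a s → closed y z Cy a (not-true⁻ s))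

  Closed⇒Component : Symmetric → ∀ {h} → C h ≡ true → (∀ v → C v ≡ true → X v ≡ false) →
    (∀ {v} → C v ≡ true → Reach Γ (compl Γ X) h v) → Closed X C → Component Γ X C
  Closed⇒Component sym-adj {h} Ch C∩X=∅ connected closed =
    (h , Ch) , C∩X=∅ , λ u v Cu _ →
      (λ Cv → Reach-trans (Reach-sym sym-adj (connected Cu)) (connected Cv)) ,
      Reach-Closed closed Cu

  Closed⇒Disconnected : ∀ {h z} → C h ≡ true → X h ≡ false → X z ≡ false → C z ≡ false →
                        Closed X C → Disconnected Γ X
  Closed⇒Disconnected Ch Xh Xz Cz closed =
    _ , _ , Xh , Xz , λ r → true≢false (Reach-Closed closed Ch r) Cz

  closed-part⇒cut : ∀ {g h z} → Symmetric → MinDegGe Γ (compl Γ X) g →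
    C h ≡ true → (∀ v → C v ≡ true → X v ≡ false) → (∀ {v} → C v ≡ true → Reach Γ (compl Γ X) h v) →
    Closed X C → X z ≡ false → C z ≡ false → ¬ Splittable Γ g C →
    GoodNeighborCut Γ g X × Attains Γ g X (∣_∣ₛ Γ X + ∣_∣ₛ Γ C)
  closed-part⇒cut sym-adj δ Ch C∩X=∅ connected closed Xz Cz unsplittable =
    (Closed⇒Disconnected Ch (C∩X=∅ _ Ch) Xz Cz closed , δ) ,
    _ , _ , Closed⇒Component sym-adj Ch C∩X=∅ connected closed , inj₂ (unsplittable , refl) , refl

  module Counting (verts-unique : Unique verts) (verts-complete : ∀ v → v ∈ verts) where

    ∣_∣ : VSet Γ → ℕ
    ∣_∣ = ∣_∣ₛ Γ

    nbhd : VSet Γ → V → VSet Γ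
    nbhd S v w = adj v w ∧ S w

    length≤∣∣ : ∀ {ys} → Unique ys → All (λ y → S y ≡ true) ys → length ys ≤ ∣ S ∣
    length≤∣∣ {S} unique ys⊆S =
      Unique⇒length≤ unique (λ {y} y∈ys → ∈-filterᵇ⁺ S (verts-complete y) (All.lookup ys⊆S y∈ys))

    ∣∣≤length : ∀ {ys} → (∀ y → S y ≡ true → y ∈ ys) → ∣ S ∣ ≤ length ys
    ∣∣≤length {S} S⊆ys =
      Unique⇒length≤ (Unique-filterᵇ S verts-unique) (λ {y} y∈ → S⊆ys y (proj₂ (∈-filterᵇ⁻ S verts y∈)))

    ∣∣-mono : {T : VSet Γ} → (∀ v → S v ≡ true → T v ≡ true) → ∣ S ∣ ≤ ∣ T ∣
    ∣∣-mono {S} {T} S⊆T = length≤∣∣ (Unique-filterᵇ S verts-unique)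
      (All.tabulate λ v∈ → S⊆T _ (proj₂ (∈-filterᵇ⁻ S verts v∈)))

    ∣∣-partition : {A B : VSet Γ} → (∀ v → C v ≡ (A v ∨ B v)) → (∀ v → (A v ∧ B v) ≡ false) →
                   ∣ C ∣ ≡ ∣ A ∣ + ∣ B ∣
    ∣∣-partition {C} {A} {B} cover disjoint = length-filterᵇ-partition C A B cover disjoint verts

    ∣∣≥1⇒member : 1 ≤ ∣ S ∣ → ∃[ v ] S v ≡ true
    ∣∣≥1⇒member {S} 1≤ with v , v∈ ← length≥1⇒member 1≤ = v , proj₂ (∈-filterᵇ⁻ S verts v∈)

    ∣∣≥2⇒members : 2 ≤ ∣ S ∣ → ∃[ u ] ∃[ v ] u ≢ v × S u ≡ true × S v ≡ true
    ∣∣≥2⇒members {S} 2≤ with u , v , u≢v , u∈ , v∈ ← length≥2⇒members (Unique-filterᵇ S verts-unique) 2≤ =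
      u , v , u≢v , proj₂ (∈-filterᵇ⁻ S verts u∈) , proj₂ (∈-filterᵇ⁻ S verts v∈)

    length-filterᵇ≤degIn : ∀ {v ns} → Unique ns → All (λ w → adj v w ≡ true) ns → length (filterᵇ S ns) ≤ degIn Γ S v
    length-filterᵇ≤degIn {S} {v} {ns} unique adjacent =
      length≤∣∣ {S = nbhd S v} (Unique-filterᵇ S unique) (All.tabulate λ w∈ →
        let w∈ns , Sw = ∈-filterᵇ⁻ S ns w∈ in ∧-true⁺ (All.lookup adjacent w∈ns) Sw)

    degIn≤length-filterᵇ : ∀ {v ns} → (∀ w → adj v w ≡ true → w ∈ ns) → degIn Γ S v ≤ length (filterᵇ S ns)
    degIn≤length-filterᵇ {S} {v} {ns} ns⊇nbhd = ∣∣≤length {S = nbhd S v} λ w e →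
      let vw , Sw = ∧-true⁻ {adj v w} e in ∈-filterᵇ⁺ S (ns⊇nbhd w vw) Sw

    neighbour : 1 ≤ degIn Γ S v → ∃[ w ] adj v w ≡ true × S w ≡ true
    neighbour {v = v} 1≤ with w , e ← ∣∣≥1⇒member 1≤ = w , ∧-true⁻ {adj v w} e

    two-neighbours : 2 ≤ degIn Γ S v →
      ∃[ w₁ ] ∃[ w₂ ] w₁ ≢ w₂ × (adj v w₁ ≡ true × S w₁ ≡ true) × (adj v w₂ ≡ true × S w₂ ≡ true)
    two-neighbours {v = v} 2≤ with w₁ , w₂ , w₁≢w₂ , e₁ , e₂ ← ∣∣≥2⇒members 2≤ =
      w₁ , w₂ , w₁≢w₂ , ∧-true⁻ {adj v w₁} e₁ , ∧-true⁻ {adj v w₂} e₂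

    neighbour-avoiding : DecidableEquality V → 2 ≤ degIn Γ S v → ∀ x → ∃[ w ] adj v w ≡ true × S w ≡ true × w ≢ x
    neighbour-avoiding _≟_ 2≤ x with w₁ , w₂ , w₁≢w₂ , (vw₁ , Sw₁) , (vw₂ , Sw₂) ← two-neighbours 2≤ | w₁ ≟ x
    ... | no w₁≢x  = w₁ , vw₁ , Sw₁ , w₁≢x
    ... | yes refl = w₂ , vw₂ , Sw₂ , w₁≢w₂ ∘ sym

    Component⇒MinDegGe : MinDegGe Γ (compl Γ X) g → Component Γ X C → MinDegGe Γ C g
    Component⇒MinDegGe {X} {g} {C} δ (_ , C∩X=∅ , connected) v Cv =
      ≤-trans (δ v X̄v) (∣∣-mono nbhd⊆)
      where
      X̄v = not-true⁺ (C∩X=∅ v Cv)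
      nbhd⊆ : ∀ w → nbhd (compl Γ X) v w ≡ true → nbhd C v w ≡ true
      nbhd⊆ w e with a , X̄w ← ∧-true⁻ {adj v w} e =
        ∧-true⁺ a (proj₂ (connected v w Cv (not-true⁻ X̄w)) (step (here X̄v) a X̄w))

    ∣∣-mono-< : {T : VSet Γ} → (∀ v → S v ≡ true → T v ≡ true) → T u ≡ true → S u ≡ false → ∣ S ∣ < ∣ T ∣
    ∣∣-mono-< {S} {u} {T} S⊆T Tu Su = begin-strict
      ∣ S ∣                  <⟨ m<m+n ∣ S ∣ (length≤∣∣ {S = T∖S} ([] ∷ []) (Tu∖Su ∷ [])) ⟩
      ∣ S ∣ + ∣ T∖S ∣        ≡⟨ ∣∣-partition cover disjoint ⟨
      ∣ T ∣                  ∎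
      where
      open Data.Nat.Properties.≤-Reasoning
      T∖S : VSet Γ
      T∖S v = T v ∧ not (S v)
      Tu∖Su : T∖S u ≡ true
      Tu∖Su rewrite Tu | Su = refl
      cover : ∀ v → T v ≡ (S v ∨ T∖S v)
      cover v with S v in e
      ... | true  = S⊆T v e
      ... | false = sym (∧-identityʳ (T v))
      disjoint : ∀ v → (S v ∧ T∖S v) ≡ false
      disjoint v with S v
      ... | true  = ∧-zeroʳ (T v)
      ... | false = refl

    -- A part A of a good split contains the whole C-neighbourhood of each of its vertices, hence all of C.
    ¬Splittable-sparse : (∀ v → C v ≡ true → degIn Γ C v ≤ g) → (∀ {u v} → C u ≡ true → C v ≡ true → Reach Γ C u v) →
                         ¬ Splittable Γ g C
    ¬Splittable-sparse {C} {g} sparse connected (A , B , (a , Aa) , (b , Bb) , cover , disjoint , δA , _) =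
      true≢false (∧-true⁺ (Reach-preserves A A-closed Aa (connected Ca Cb)) Bb) (disjoint b)
      where
      Ca = trans (cover a) (∨-trueˡ Aa)
      Cb = trans (cover b) (∨-trueʳ {a = A b} Bb)
      A-closed : ∀ {y z} → A y ≡ true → adj y z ≡ true → C z ≡ true → A z ≡ true
      A-closed {y} {z} Ay yz Cz with A z in Az
      ... | true  = refl
      ... | false = ⊥-elim (≤⇒≯ (≤-trans (sparse y Cy) (δA y Ay)) (∣∣-mono-< nbhdA⊆nbhdC (∧-true⁺ yz Cz) nbhdA-z))
        where
        Cy = trans (cover y) (∨-trueˡ Ay)
        nbhdA⊆nbhdC : ∀ w → nbhd A y w ≡ true → nbhd C y w ≡ true
        nbhdA⊆nbhdC w e with yw , Aw ← ∧-true⁻ {adj y w} e = ∧-true⁺ yw (trans (cover w) (∨-trueˡ Aw))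
        nbhdA-z : nbhd A y z ≡ false
        nbhdA-z rewrite yz | Az = refl

    OrderBound : ℕ → ℕ → Set
    OrderBound g k = ∀ S {v} → S v ≡ true → MinDegGe Γ S g → k ≤ ∣ S ∣

    CompVal≥ : OrderBound g k → GoodNeighborCut Γ g X → Component Γ X C → CompVal Γ g C t → k ≤ t
    CompVal≥ bound _ _ (inj₁ (_ , A , _ , ((_ , Av) , _ , _ , _ , δA , _) , _ , refl , _)) = bound A Av δA
    CompVal≥ bound (_ , δ) comp@((_ , Cv) , _) (inj₂ (_ , refl)) = bound _ Cv (Component⇒MinDegGe δ comp)

    small⇒¬Splittable : OrderBound g k → ∣ C ∣ < k + k → ¬ Splittable Γ g C
    small⇒¬Splittable {C = C} bound small (A , B , (_ , Au) , (_ , Bv) , cover , disjoint , δA , δB) =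
      ≤⇒≯ (+-mono-≤ (bound A Au δA) (bound B Bv δB)) (subst (_< _) (∣∣-partition cover disjoint) small)

    orderBound₀ : OrderBound 0 1
    orderBound₀ S Sv _ = length≤∣∣ ([] ∷ []) (Sv ∷ [])

    orderBound₁ : Loopless → OrderBound 1 2
    orderBound₁ loopless S {v} Sv δ with w , vw , Sw ← neighbour (δ v Sv) =
      length≤∣∣ ((adj⇒≢ loopless vw ∷ []) ∷ [] ∷ []) (Sv ∷ Sw ∷ [])

    orderBound₂ : DecidableEquality V → Loopless → TriangleFree → OrderBound 2 4
    orderBound₂ _≟_ loopless triangle-free S {x} Sx δ
      with y₁ , y₂ , y₁≢y₂ , (xy₁ , Sy₁) , (xy₂ , Sy₂) ← two-neighbours (δ x Sx)
      with z , y₁z , Sz , z≢x ← neighbour-avoiding _≟_ (δ y₁ Sy₁) x =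
      length≤∣∣
        ((adj⇒≢ loopless xy₁ ∷ adj⇒≢ loopless xy₂ ∷ z≢x ∘ sym ∷ []) ∷
         (y₁≢y₂ ∷ adj⇒≢ loopless y₁z ∷ []) ∷
         ((λ { refl → triangle-free x y₁ y₂ xy₁ xy₂ y₁z }) ∷ []) ∷ [] ∷ [])
        (Sx ∷ Sy₁ ∷ Sy₂ ∷ Sz ∷ [])

module Cycle (k : ℕ) where

  private
    V = Fin (suc k)
    variable
      i j l c : V

  next : V → V
  next i with k ≟ toℕ i
  ... | yes _   = zero
  ... | no k≢i = suc (lower₁ i k≢i)

  prev : V → V
  prev zero    = fromℕ k
  prev (suc i) = inject₁ i

  Follows : V → V → Set
  Follows i j = toℕ j ≡ suc (toℕ i) ⊎ (toℕ i ≡ k × toℕ j ≡ 0)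

  follows-next : ∀ i → Follows i (next i)
  follows-next i with k ≟ toℕ i
  ... | yes k≡i = inj₂ (sym k≡i , refl)
  ... | no k≢i  = inj₁ (cong suc (toℕ-lower₁ i k≢i))

  prev-follows : ∀ i → Follows (prev i) i
  prev-follows zero    = inj₂ (toℕ-fromℕ k , refl)
  prev-follows (suc i) = inj₁ (cong suc (sym (toℕ-inject₁ i)))

  1+k-out-of-range : toℕ j ≡ suc (toℕ i) → toℕ i ≢ k
  1+k-out-of-range {j} e i≡k = ≤⇒≯ (toℕ≤pred[n] j) (≤-reflexive (sym (trans e (cong suc i≡k))))

  Follows-functional : Follows i j → Follows i l → j ≡ l
  Follows-functional (inj₁ e₁)        (inj₁ e₂)        = toℕ-injective (trans e₁ (sym e₂))
  Follows-functional (inj₂ (_ , e₁))  (inj₂ (_ , e₂))  = toℕ-injective (trans e₁ (sym e₂))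
  Follows-functional (inj₁ e₁)        (inj₂ (i≡k , _)) = ⊥-elim (1+k-out-of-range e₁ i≡k)
  Follows-functional (inj₂ (i≡k , _)) (inj₁ e₂)        = ⊥-elim (1+k-out-of-range e₂ i≡k)

  Follows-injective : Follows i l → Follows j l → i ≡ j
  Follows-injective (inj₁ e₁)       (inj₁ e₂)       = toℕ-injective (suc-injective (trans (sym e₁) e₂))
  Follows-injective (inj₂ (e₁ , _)) (inj₂ (e₂ , _)) = toℕ-injective (trans e₁ (sym e₂))
  Follows-injective (inj₁ e₁)       (inj₂ (_ , e₂)) = ⊥-elim (0≢1+n (trans (sym e₂) e₁))
  Follows-injective (inj₂ (_ , e₁)) (inj₁ e₂)       = ⊥-elim (0≢1+n (trans (sym e₁) e₂))

  next-unique : Follows i j → j ≡ next i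
  next-unique i→j = Follows-functional i→j (follows-next _)

  next-prev : ∀ i → next (prev i) ≡ i
  next-prev i = sym (next-unique (prev-follows i))

  prev-next : ∀ i → prev (next i) ≡ i
  prev-next i = Follows-injective (prev-follows (next i)) (follows-next i)

  cycAdj-sym : ∀ i j → cycAdj (suc k) i j ≡ cycAdj (suc k) j i
  cycAdj-sym i j = ∨-swap ⌊ toℕ j ≟ suc (toℕ i) ⌋ ⌊ toℕ i ≟ suc (toℕ j) ⌋
    (⌊ suc (toℕ i) ≟ suc k ⌋ ∧ ⌊ toℕ j ≟ 0 ⌋) (⌊ suc (toℕ j) ≟ suc k ⌋ ∧ ⌊ toℕ i ≟ 0 ⌋)

  wrap-around⁻ : ⌊ suc (toℕ i) ≟ suc k ⌋ ∧ ⌊ toℕ j ≟ 0 ⌋ ≡ true → toℕ i ≡ k × toℕ j ≡ 0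
  wrap-around⁻ e = let e₁ , e₂ = ∧-true⁻ e in suc-injective (≟-sound e₁) , ≟-sound e₂

  cycAdj⇒Follows : cycAdj (suc k) i j ≡ true → Follows i j ⊎ Follows j i
  cycAdj⇒Follows {i} {j} e with ∨-true⁻ e
  ... | inj₁ e₁ = inj₁ (inj₁ (≟-sound e₁))
  ... | inj₂ e₂ with ∨-true⁻ e₂
  ...   | inj₁ e₃ = inj₂ (inj₁ (≟-sound e₃))
  ...   | inj₂ e₄ with ∨-true⁻ e₄
  ...     | inj₁ e₅ = inj₁ (inj₂ (wrap-around⁻ e₅))
  ...     | inj₂ e₆ = inj₂ (inj₂ (wrap-around⁻ e₆))

  Follows⇒cycAdj : Follows i j → cycAdj (suc k) i j ≡ true
  Follows⇒cycAdj (inj₁ j≡1+i) = ∨-trueˡ (≟-complete j≡1+i)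
  Follows⇒cycAdj {i} {j} (inj₂ (i≡k , j≡0)) =
    ∨-trueʳ {a = ⌊ toℕ j ≟ suc (toℕ i) ⌋} (∨-trueʳ {a = ⌊ toℕ i ≟ suc (toℕ j) ⌋}
      (∨-trueˡ (∧-true⁺ (≟-complete (cong suc i≡k)) (≟-complete j≡0))))

  cycAdj⇒next⊎prev : cycAdj (suc k) i j ≡ true → j ≡ next i ⊎ j ≡ prev i
  cycAdj⇒next⊎prev {i} {j} e with cycAdj⇒Follows {i} {j} e
  ... | inj₁ i→j = inj₁ (next-unique i→j)
  ... | inj₂ j→i = inj₂ (Follows-injective j→i (prev-follows i))

  cycAdj-next : ∀ i → cycAdj (suc k) i (next i) ≡ true
  cycAdj-next i = Follows⇒cycAdj (follows-next i)

  cycAdj-prev : ∀ i → cycAdj (suc k) i (prev i) ≡ true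
  cycAdj-prev i = trans (cycAdj-sym i (prev i)) (Follows⇒cycAdj (prev-follows i))

  next^ : ℕ → V → V
  next^ zero    i = i
  next^ (suc j) i = next (next^ j i)

  -- At most one wrap-around happens within k steps.
  toℕ-next^ : ∀ j i → j ≤ k → toℕ (next^ j i) ≡ toℕ i + j ⊎ toℕ (next^ j i) + suc k ≡ toℕ i + j
  toℕ-next^ zero i _ = inj₁ (sym (+-identityʳ (toℕ i)))
  toℕ-next^ (suc j) i 1+j≤k
    with toℕ-next^ j i (≤-trans (n≤1+n j) 1+j≤k) | follows-next (next^ j i)
  ... | inj₁ eq | inj₁ e = inj₁ (trans e (trans (cong suc eq) (sym (+-suc (toℕ i) j))))
  ... | inj₂ eq | inj₁ e = inj₂ (trans (cong (_+ suc k) e) (trans (cong suc eq) (sym (+-suc (toℕ i) j))))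
  ... | inj₁ eq | inj₂ (x≡k , e) =
    inj₂ (trans (cong (_+ suc k) e) (trans (cong suc (trans (sym x≡k) eq)) (sym (+-suc (toℕ i) j))))
  ... | inj₂ eq | inj₂ (x≡k , _) =
    ⊥-elim (≤⇒≯ (+-mono-≤ (toℕ≤pred[n] i) (≤-trans (n≤1+n j) 1+j≤k))
                 (subst (k + k <_) (trans (cong (_+ suc k) (sym x≡k)) eq) (+-monoʳ-< k (n<1+n k))))

  next^≢id : ∀ {j} i → 1 ≤ j → j ≤ k → next^ j i ≢ i
  next^≢id {j} i 1≤j j≤k eq with toℕ-next^ j i j≤k
  ... | inj₁ e = <-irrefl (sym (+-cancelˡ-≡ (toℕ i) j 0 (trans (sym e) (trans (cong toℕ eq) (sym (+-identityʳ _)))))) 1≤j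
  ... | inj₂ e = <-irrefl (sym (+-cancelˡ-≡ (toℕ i) (suc k) j (trans (sym (cong (_+ suc k) (cong toℕ eq))) e))) (s≤s j≤k)

  next^-zero : ∀ i → next^ (toℕ i) zero ≡ i
  next^-zero i with toℕ-next^ (toℕ i) zero (toℕ≤pred[n] i)
  ... | inj₁ e = toℕ-injective e
  ... | inj₂ e = ⊥-elim (≤⇒≯ (toℕ≤pred[n] i) (subst (suc k ≤_) e (m≤n+m (suc k) _)))

  next≢id : 1 ≤ k → next i ≢ i
  next≢id {i} = next^≢id i ≤-refl

  prev≢id : 1 ≤ k → prev i ≢ i
  prev≢id {i} 1≤k eq = next≢id 1≤k (trans (cong next (sym eq)) (next-prev i))

  next≢prev : 2 ≤ k → next i ≢ prev i
  next≢prev {i} 2≤k eq = next^≢id {2} i (s≤s z≤n) 2≤k (trans (cong next eq) (next-prev i))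

  cycAdj-irrefl : 1 ≤ k → cycAdj (suc k) i i ≢ true
  cycAdj-irrefl {i} 1≤k e with cycAdj⇒next⊎prev {i} {i} e
  ... | inj₁ i≡next = next≢id 1≤k (sym i≡next)
  ... | inj₂ i≡prev = prev≢id 1≤k (sym i≡prev)

  -- A triangle would need next and prev of a vertex to be adjacent, i.e. a cycle of length ≤ 3.
  cycAdj-triangle-free : 3 ≤ k → cycAdj (suc k) i j ≡ true → cycAdj (suc k) i l ≡ true → cycAdj (suc k) j l ≡ true → ⊥
  cycAdj-triangle-free {i} {j} {l} 3≤k@(s≤s _) ij il jl
    with cycAdj⇒next⊎prev {i} {j} ij | cycAdj⇒next⊎prev {i} {l} il | cycAdj⇒next⊎prev {j} {l} jl
  ... | inj₁ refl | inj₁ refl | _      = cycAdj-irrefl {next i} (s≤s z≤n) jl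
  ... | inj₂ refl | inj₂ refl | _      = cycAdj-irrefl {prev i} (s≤s z≤n) jl
  ... | inj₁ refl | inj₂ refl | inj₁ e = next^≢id {3} i (s≤s z≤n) 3≤k (trans (cong next (sym e)) (next-prev i))
  ... | inj₁ refl | inj₂ refl | inj₂ e = prev≢id (s≤s z≤n) (trans e (prev-next i))
  ... | inj₂ refl | inj₁ refl | inj₁ e = next≢id (s≤s z≤n) (trans e (next-prev i))
  ... | inj₂ refl | inj₁ refl | inj₂ e =
    next^≢id {3} i (s≤s z≤n) 3≤k
      (trans (cong (next ∘ next) e) (trans (cong next (next-prev (prev i))) (next-prev i)))

  -- The position of i on the path C_{k+1} − c, counted from next c.
  rank : V → V → ℕ
  rank c i with toℕ c <? toℕ i
  ... | yes _ = toℕ i ∸ suc (toℕ c)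
  ... | no _  = toℕ i + (k ∸ toℕ c)

  rank<k : i ≢ c → rank c i < k
  rank<k {i} {c} i≢c with toℕ c <? toℕ i
  ... | yes c<i = <-≤-trans (∸-monoʳ-< (n<1+n (toℕ c)) c<i) (≤-trans (m∸n≤m (toℕ i) (toℕ c)) (toℕ≤pred[n] i))
  ... | no c≮i  = <-≤-trans (+-monoˡ-< (k ∸ toℕ c) i<c) (≤-reflexive (m+[n∸m]≡n (toℕ≤pred[n] c)))
    where
    i<c : toℕ i < toℕ c
    i<c = ≤∧≢⇒< (≮⇒≥ c≮i) (i≢c ∘ toℕ-injective)

  rank-next : i ≢ c → next i ≢ c → rank c (next i) ≡ suc (rank c i)
  rank-next {i} {c} i≢c _ with next i | follows-next i
  ... | j | i→j with toℕ c <? toℕ j | toℕ c <? toℕ i | i→j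
  ...   | yes c<j | yes c<i | inj₁ j≡1+i = trans (cong (_∸ suc (toℕ c)) j≡1+i) (+-∸-assoc 1 c<i)
  ...   | no _    | no _    | inj₁ j≡1+i = cong (_+ (k ∸ toℕ c)) j≡1+i
  ...   | no c≮j  | yes c<i | inj₁ j≡1+i = ⊥-elim (c≮j (<-trans c<i (≤-reflexive (sym j≡1+i))))
  ...   | yes c<j | no c≮i  | inj₁ j≡1+i =
    ⊥-elim (i≢c (toℕ-injective (sym (≤-antisym (≤-pred (subst (toℕ c <_) j≡1+i c<j)) (≮⇒≥ c≮i)))))
  ...   | yes c<j | _       | inj₂ (_ , j≡0) = ⊥-elim (n≮0 (subst (toℕ c <_) j≡0 c<j))
  ...   | no _    | yes c<i | inj₂ (i≡k , j≡0) =
    trans (cong (_+ (k ∸ toℕ c)) j≡0)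
          (trans (+-∸-assoc 1 (subst (toℕ c <_) i≡k c<i)) (cong (λ x → suc (x ∸ suc (toℕ c))) (sym i≡k)))
  ...   | no _    | no c≮i  | inj₂ (i≡k , _) =
    ⊥-elim (c≮i (≤∧≢⇒< (subst (toℕ c ≤_) (sym i≡k) (toℕ≤pred[n] c)) (i≢c ∘ sym ∘ toℕ-injective)))

  rank-prev : i ≢ c → prev i ≢ c → suc (rank c (prev i)) ≡ rank c i
  rank-prev {i} i≢c prev≢c =
    trans (sym (rank-next prev≢c (λ e → i≢c (trans (sym (next-prev i)) e)))) (cong (rank _) (next-prev i))

module Torus (n₁ m₁ : ℕ) where

  module H = Cycle n₁
  module W = Cycle m₁

  Γ : FinGraph
  Γ = torus (suc n₁) (suc m₁)

  open FinGraph Γ public using (V; verts; adj)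

  right left down up : V → V
  right x = H.next (proj₁ x) , proj₂ x
  left  x = H.prev (proj₁ x) , proj₂ x
  down  x = proj₁ x , W.next (proj₂ x)
  up    x = proj₁ x , W.prev (proj₂ x)

  data Move (x : V) : V → Set where
    to-right : Move x (right x)
    to-left  : Move x (left x)
    to-down  : Move x (down x)
    to-up    : Move x (up x)

  adj-horizontal : ∀ {a a′} b → cycAdj (suc n₁) a a′ ≡ true → adj (a , b) (a′ , b) ≡ true
  adj-horizontal {a} {a′} b e = ∨-trueʳ {a = ⌊ toℕ a ≟ toℕ a′ ⌋ ∧ cycAdj (suc m₁) b b} (∧-true⁺ (≟-complete refl) e)

  adj-vertical : ∀ a {b b′} → cycAdj (suc m₁) b b′ ≡ true → adj (a , b) (a , b′) ≡ true
  adj-vertical a e = ∨-trueˡ (∧-true⁺ (≟-complete {toℕ a} refl) e)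

  adj⁻ : ∀ {a b a′ b′} → adj (a , b) (a′ , b′) ≡ true →
         (b′ ≡ b × cycAdj (suc n₁) a a′ ≡ true) ⊎ (a′ ≡ a × cycAdj (suc m₁) b b′ ≡ true)
  adj⁻ {a} {b} {a′} {b′} e with ∨-true⁻ {⌊ toℕ a ≟ toℕ a′ ⌋ ∧ cycAdj (suc m₁) b b′} e
  ... | inj₁ e₁ with a≡ , c ← ∧-true⁻ {⌊ toℕ a ≟ toℕ a′ ⌋} e₁ = inj₂ (toℕ-injective (sym (≟-sound a≡)) , c)
  ... | inj₂ e₂ with b≡ , c ← ∧-true⁻ {⌊ toℕ b ≟ toℕ b′ ⌋} e₂ = inj₁ (toℕ-injective (sym (≟-sound b≡)) , c)

  Move⇒adj : ∀ {x y} → Move x y → adj x y ≡ true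
  Move⇒adj {a , b} to-right = adj-horizontal b (H.cycAdj-next a)
  Move⇒adj {a , b} to-left  = adj-horizontal b (H.cycAdj-prev a)
  Move⇒adj {a , b} to-down  = adj-vertical a (W.cycAdj-next b)
  Move⇒adj {a , b} to-up    = adj-vertical a (W.cycAdj-prev b)

  adj⇒Move : ∀ {x y} → adj x y ≡ true → Move x y
  adj⇒Move {a , b} {a′ , b′} e with adj⁻ {a} {b} {a′} {b′} e
  ... | inj₁ (refl , c) with H.cycAdj⇒next⊎prev {a} {a′} c
  ...   | inj₁ refl = to-right
  ...   | inj₂ refl = to-left
  adj⇒Move {a , b} {a′ , b′} e | inj₂ (refl , c) with W.cycAdj⇒next⊎prev {b} {b′} c
  ...   | inj₁ refl = to-down
  ...   | inj₂ refl = to-up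

  left-right : ∀ x → left (right x) ≡ x
  left-right (a , b) = cong (_, b) (H.prev-next a)

  right-left : ∀ x → right (left x) ≡ x
  right-left (a , b) = cong (_, b) (H.next-prev a)

  up-down : ∀ x → up (down x) ≡ x
  up-down (a , b) = cong (a ,_) (W.prev-next b)

  down-up : ∀ x → down (up x) ≡ x
  down-up (a , b) = cong (a ,_) (W.next-prev b)

  Move-sym : ∀ {x y} → Move x y → Move y x
  Move-sym {x} to-right = subst (Move (right x)) (left-right x) to-left
  Move-sym {x} to-left  = subst (Move (left x)) (right-left x) to-right
  Move-sym {x} to-down  = subst (Move (down x)) (up-down x) to-up
  Move-sym {x} to-up    = subst (Move (up x)) (down-up x) to-down

  open Graph Γ public

  adj-sym : Symmetric
  adj-sym x y e = Move⇒adj {y} (Move-sym (adj⇒Move {x} {y} e))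

  Reach-along-row : ∀ {S : VSet Γ} {b} → (∀ a → S (a , b) ≡ true) → ∀ a a′ → Reach Γ S (a , b) (a′ , b)
  Reach-along-row {S} {b} free a a′ = Reach-trans (Reach-sym adj-sym (from-zero a)) (from-zero a′)
    where
    walk : ∀ j → Reach Γ S (zero , b) (H.next^ j zero , b)
    walk zero    = here (free zero)
    walk (suc j) = step (walk j) (Move⇒adj {H.next^ j zero , b} to-right) (free _)
    from-zero : ∀ a → Reach Γ S (zero , b) (a , b)
    from-zero a = subst (λ a′ → Reach Γ S (zero , b) (a′ , b)) (H.next^-zero a) (walk (toℕ a))

  Reach-along-column : ∀ {S : VSet Γ} {a} → (∀ b → S (a , b) ≡ true) → ∀ b b′ → Reach Γ S (a , b) (a , b′)
  Reach-along-column {S} {a} free b b′ = Reach-trans (Reach-sym adj-sym (from-zero b)) (from-zero b′)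
    where
    walk : ∀ j → Reach Γ S (a , zero) (a , W.next^ j zero)
    walk zero    = here (free zero)
    walk (suc j) = step (walk j) (Move⇒adj {a , W.next^ j zero} to-down) (free _)
    from-zero : ∀ b → Reach Γ S (a , zero) (a , b)
    from-zero b = subst (λ b′ → Reach Γ S (a , zero) (a , b′)) (W.next^-zero b) (walk (toℕ b))

  verts-unique : Unique verts
  verts-unique = Unique.cartesianProduct⁺ (Unique.allFin⁺ (suc n₁)) (Unique.allFin⁺ (suc m₁))

  verts-complete : ∀ v → v ∈ verts
  verts-complete (a , b) = ∈-cartesianProduct⁺ (∈-allFin a) (∈-allFin b)

  open Counting verts-unique verts-complete public

  _≟V_ : DecidableEquality V
  _≟V_ = ≡-dec Fin._≟_ Fin._≟_

  module Distinct (2≤n₁ : 2 ≤ n₁) (2≤m₁ : 2 ≤ m₁) where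

    private
      1≤n₁ = ≤-trans (s≤s z≤n) 2≤n₁
      1≤m₁ = ≤-trans (s≤s z≤n) 2≤m₁

    Move⇒≢ : ∀ {x y} → Move x y → x ≢ y
    Move⇒≢ {a , b} to-right e = H.next≢id 1≤n₁ (sym (cong proj₁ e))
    Move⇒≢ {a , b} to-left  e = H.prev≢id 1≤n₁ (sym (cong proj₁ e))
    Move⇒≢ {a , b} to-down  e = W.next≢id 1≤m₁ (sym (cong proj₂ e))
    Move⇒≢ {a , b} to-up    e = W.prev≢id 1≤m₁ (sym (cong proj₂ e))

    loopless : Loopless
    loopless x e = Move⇒≢ (adj⇒Move {x} {x} e) refl

    right≢left : ∀ x → right x ≢ left x
    right≢left x = H.next≢prev 2≤n₁ ∘ cong proj₁

    right≢vertical : ∀ x {b} → right x ≢ (proj₁ x , b)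
    right≢vertical x = H.next≢id 1≤n₁ ∘ cong proj₁

    left≢vertical : ∀ x {b} → left x ≢ (proj₁ x , b)
    left≢vertical x = H.prev≢id 1≤n₁ ∘ cong proj₁

    down≢up : ∀ x → down x ≢ up x
    down≢up x = W.next≢prev 2≤m₁ ∘ cong proj₂

    moves : V → List V
    moves x = right x ∷ left x ∷ down x ∷ up x ∷ []

    moves-unique : ∀ x → Unique (moves x)
    moves-unique x =
      (right≢left x ∷ right≢vertical x ∷ right≢vertical x ∷ []) ∷ (left≢vertical x ∷ left≢vertical x ∷ []) ∷
      (down≢up x ∷ []) ∷ [] ∷ []

    moves-adj : ∀ x → All (λ y → adj x y ≡ true) (moves x)
    moves-adj x = Move⇒adj {x} to-right ∷ Move⇒adj {x} to-left ∷ Move⇒adj {x} to-down ∷ Move⇒adj {x} to-up ∷ []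

    Move⇒∈moves : ∀ {x y} → Move x y → y ∈ moves x
    Move⇒∈moves to-right = here refl
    Move⇒∈moves to-left  = there (here refl)
    Move⇒∈moves to-down  = there (there (here refl))
    Move⇒∈moves to-up    = there (there (there (here refl)))

    degIn≡free-moves : ∀ S x → degIn Γ S x ≡ length (filterᵇ S (moves x))
    degIn≡free-moves S x = ≤-antisym (degIn≤length-filterᵇ {S = S} {v = x} (λ y → Move⇒∈moves ∘ adj⇒Move {x} {y}))
                                     (length-filterᵇ≤degIn {S = S} {v = x} (moves-unique x) (moves-adj x))

    module _ (3≤n₁ : 3 ≤ n₁) (3≤m₁ : 3 ≤ m₁) where

      triangle-free : TriangleFree
      triangle-free (a , b) (a₁ , b₁) (a₂ , b₂) e₁ e₂ e₃
        with adj⁻ {a} {b} {a₁} {b₁} e₁ | adj⁻ {a} {b} {a₂} {b₂} e₂ | adj⁻ {a₁} {b₁} {a₂} {b₂} e₃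
      ... | inj₁ (refl , c₁) | inj₁ (refl , c₂) | inj₁ (_ , c₃)    = H.cycAdj-triangle-free {a} {a₁} {a₂} 3≤n₁ c₁ c₂ c₃
      ... | inj₁ (refl , c₁) | inj₁ (refl , c₂) | inj₂ (_ , c₃)    = W.cycAdj-irrefl {b} 1≤m₁ c₃
      ... | inj₁ (refl , c₁) | inj₂ (refl , c₂) | inj₁ (refl , c₃) = W.cycAdj-irrefl {b} 1≤m₁ c₂
      ... | inj₁ (refl , c₁) | inj₂ (refl , c₂) | inj₂ (refl , c₃) = H.cycAdj-irrefl {a} 1≤n₁ c₁
      ... | inj₂ (refl , c₁) | inj₁ (refl , c₂) | inj₁ (refl , c₃) = W.cycAdj-irrefl {b} 1≤m₁ c₁
      ... | inj₂ (refl , c₁) | inj₁ (refl , c₂) | inj₂ (refl , c₃) = H.cycAdj-irrefl {a} 1≤n₁ c₂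
      ... | inj₂ (refl , c₁) | inj₂ (refl , c₂) | inj₂ (_ , c₃)    = W.cycAdj-triangle-free {b} {b₁} {b₂} 3≤m₁ c₁ c₂ c₃
      ... | inj₂ (refl , c₁) | inj₂ (refl , c₂) | inj₁ (_ , c₃)    = H.cycAdj-irrefl {a} 1≤n₁ c₃

      orderBound₂-torus : OrderBound 2 4
      orderBound₂-torus = orderBound₂ _≟V_ loopless triangle-free

module LowerBounds (n₁ m₁ : ℕ) where

  open Torus n₁ m₁

  module Core (X : VSet Γ) {c₀ r₀} (column-free : ∀ b → X (c₀ , b) ≡ false) (row-free : ∀ a → X (a , r₀) ≡ false)
              {w} (Xw : X w ≡ false) (w↛hub : ¬ Reach Γ (compl Γ X) w (c₀ , r₀)) where

    S : VSet Γ
    S = compl Γ X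

    D : V → Set
    D = Reach Γ S w

    Dw : D w
    Dw = here (not-true⁺ Xw)

    D-step : ∀ {x y} → D x → Move x y → X y ≡ false → D y
    D-step {x} Dx m Xy = step Dx (Move⇒adj {x} m) (not-true⁺ Xy)

    D-column≢c₀ : ∀ {x} → D x → proj₁ x ≢ c₀
    D-column≢c₀ {a , b} Dx a≡c₀ = w↛hub (Reach-trans Dx
      (subst (λ c → Reach Γ S (c , b) (c₀ , r₀)) (sym a≡c₀) (Reach-along-column (not-true⁺ ∘ column-free) b r₀)))

    D-row≢r₀ : ∀ {x} → D x → proj₂ x ≢ r₀
    D-row≢r₀ {a , b} Dx b≡r₀ = w↛hub (Reach-trans Dx
      (subst (λ r → Reach Γ S (a , r) (c₀ , r₀)) (sym b≡r₀) (Reach-along-row (not-true⁺ ∘ row-free) a c₀)))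

    Move-column≢c₀ : ∀ {x y} → D x → Move x y → proj₁ y ≢ c₀
    Move-column≢c₀ {y = a , b} Dx m a≡c₀ with X (a , b) in e
    ... | true  = true≢false e (subst (λ c → X (c , b) ≡ false) (sym a≡c₀) (column-free b))
    ... | false = D-column≢c₀ (D-step Dx m e) a≡c₀

    Move-row≢r₀ : ∀ {x y} → D x → Move x y → proj₂ y ≢ r₀
    Move-row≢r₀ {y = a , b} Dx m b≡r₀ with X (a , b) in e
    ... | true  = true≢false e (subst (λ r → X (a , r) ≡ false) (sym b≡r₀) (row-free a))
    ... | false = D-row≢r₀ (D-step Dx m e) b≡r₀

    -- Coordinates in which the part of the torus avoiding column c₀ and row r₀ is a grid.
    ρh ρv : V → ℕ
    ρh x = H.rank c₀ (proj₁ x)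
    ρv x = W.rank r₀ (proj₂ x)

    record Axis : Set where
      field
        fwd bwd    : V → V
        fwd-Move   : ∀ x → Move x (fwd x)
        bwd-Move   : ∀ x → Move x (bwd x)
        fwd-bwd    : ∀ x → fwd (bwd x) ≡ x
        along      : V → ℕ
        across     : V → ℕ
        size       : ℕ
        along<size : ∀ {x} → D x → along x < size
        along-fwd  : ∀ {x} → D x → along (fwd x) ≡ suc (along x)
        along-bwd  : ∀ {x} → D x → suc (along (bwd x)) ≡ along x
        across-fwd : ∀ x → across (fwd x) ≡ across x
        across-bwd : ∀ x → across (bwd x) ≡ across x

    horizontal : Axis
    horizontal = record
      { fwd = right ; bwd = left ; fwd-Move = λ _ → to-right ; bwd-Move = λ _ → to-left ; fwd-bwd = right-left
      ; along = ρh ; across = ρv ; size = n₁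
      ; along<size = λ Dx → H.rank<k (D-column≢c₀ Dx)
      ; along-fwd  = λ Dx → H.rank-next (D-column≢c₀ Dx) (Move-column≢c₀ Dx to-right)
      ; along-bwd  = λ Dx → H.rank-prev (D-column≢c₀ Dx) (Move-column≢c₀ Dx to-left)
      ; across-fwd = λ _ → refl ; across-bwd = λ _ → refl
      }

    vertical : Axis
    vertical = record
      { fwd = down ; bwd = up ; fwd-Move = λ _ → to-down ; bwd-Move = λ _ → to-up ; fwd-bwd = down-up
      ; along = ρv ; across = ρh ; size = m₁
      ; along<size = λ Dx → W.rank<k (D-row≢r₀ Dx)
      ; along-fwd  = λ Dx → W.rank-next (D-row≢r₀ Dx) (Move-row≢r₀ Dx to-down)
      ; along-bwd  = λ Dx → W.rank-prev (D-row≢r₀ Dx) (Move-row≢r₀ Dx to-up)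
      ; across-fwd = λ _ → refl ; across-bwd = λ _ → refl
      }

    last-before-X : (mv : V → V) → (∀ x → Move x (mv x)) →
                    (μ : V → ℕ) → (∀ {x} → D x → D (mv x) → μ (mv x) < μ x) →
                    (R : V → V → Set) → (∀ {x} → R x x) → (∀ {x y z} → R x y → R y z → R x z) →
                    (∀ {x} → D x → R x (mv x)) →
                    ∀ {x} → D x → ∃[ y ] D y × X (mv y) ≡ true × R x y
    last-before-X mv mv-Move μ μ-mv R R-refl R-trans R-mv {x} Dx = go x (<-wellFounded (μ x)) Dx
      where
      go : ∀ x → Acc _<_ (μ x) → D x → ∃[ y ] D y × X (mv y) ≡ true × R x y
      go x (acc smaller) Dx with X (mv x) in e
      ... | true  = x , Dx , e , R-refl
      ... | false =
        let Dmx = D-step Dx (mv-Move x) e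
            y , Dy , Xmy , mx-R-y = go (mv x) (smaller (μ-mv Dx Dmx)) Dmx
        in  y , Dy , Xmy , R-trans (R-mv Dx) mx-R-y

    module _ (A : Axis) where
      open Axis A

      last-fwd : ∀ {x} → D x → ∃[ y ] D y × X (fwd y) ≡ true × (across y ≡ across x × along x ≤ along y)
      last-fwd = last-before-X fwd fwd-Move (λ x → size ∸ along x)
        (λ {x} Dx Dfx → ∸-monoʳ-< (≤-reflexive (sym (along-fwd Dx))) (<⇒≤ (along<size Dfx)))
        (λ x y → across y ≡ across x × along x ≤ along y) (refl , ≤-refl)
        (λ (e₁ , l₁) (e₂ , l₂) → trans e₂ e₁ , ≤-trans l₁ l₂)
        (λ {x} Dx → across-fwd x , ≤-trans (n≤1+n _) (≤-reflexive (sym (along-fwd Dx))))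

      last-bwd : ∀ {x} → D x → ∃[ y ] D y × X (bwd y) ≡ true × (across y ≡ across x × along y ≤ along x)
      last-bwd = last-before-X bwd bwd-Move along (λ Dx _ → ≤-reflexive (along-bwd Dx))
        (λ x y → across y ≡ across x × along y ≤ along x) (refl , ≤-refl)
        (λ (e₁ , l₁) (e₂ , l₂) → trans e₂ e₁ , ≤-trans l₂ l₁)
        (λ {x} Dx → across-bwd x , ≤-trans (n≤1+n _) (≤-reflexive (along-bwd Dx)))

      ahead : ∀ {x} → D x → ∃[ p ] X p ≡ true × across p ≡ across x × along x < along p
      ahead Dx =
        let y , Dy , Xfy , y-line , x≤y = last-fwd Dx in
        fwd y , Xfy , trans (across-fwd y) y-line , ≤-trans (s≤s x≤y) (≤-reflexive (sym (along-fwd Dy)))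

      behind : ∀ {x} → D x → ∃[ p ] X p ≡ true × across p ≡ across x × along p < along x
      behind Dx =
        let y , Dy , Xby , y-line , y≤x = last-bwd Dx in
        bwd y , Xby , trans (across-bwd y) y-line , ≤-trans (≤-reflexive (along-bwd Dy)) y≤x

    -- Blockers are listed in increasing lexicographic order of their keys, which makes them distinct.
    key : Axis → V → ℕ × ℕ
    key A x = Axis.along A x , Axis.across A x

    module Frame (A B : Axis) (along≡across : ∀ x → Axis.along B x ≡ Axis.across A x)
                              (across≡along : ∀ x → Axis.across B x ≡ Axis.along A x) where
      open Axis A

      ahead⊥ : ∀ {x} → D x → ∃[ p ] X p ≡ true × along p ≡ along x × across x < across p
      ahead⊥ {x} Dx =
        let p , Xp , e , l = ahead B Dx in
        p , Xp , trans (sym (across≡along p)) (trans e (across≡along x)) , subst₂ _<_ (along≡across x) (along≡across p) l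

      behind⊥ : ∀ {x} → D x → ∃[ p ] X p ≡ true × along p ≡ along x × across p < across x
      behind⊥ {x} Dx =
        let p , Xp , e , l = behind B Dx in
        p , Xp , trans (sym (across≡along p)) (trans e (across≡along x)) , subst₂ _<_ (along≡across p) (along≡across x) l

      four-blockers : 4 ≤ ∣ X ∣
      four-blockers =
        let p₁ , X₁ , _ , l₁  = behind A Dw
            p₂ , X₂ , e₂ , l₂ = behind⊥ Dw
            p₃ , X₃ , e₃ , l₃ = ahead⊥ Dw
            p₄ , X₄ , _ , l₄  = ahead A Dw
        in
        length≤∣∣ {S = X} (Linked≺⇒Unique (key A)
            (inj₁ (subst (along p₁ <_) (sym e₂) l₁) ∷ inj₂ (trans e₂ (sym e₃) , <-trans l₂ l₃) ∷
             inj₁ (subst (_< along p₄) (sym e₃) l₄) ∷ [-]))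
          (X₁ ∷ X₂ ∷ X₃ ∷ X₄ ∷ [])

      six-blockers : ∀ {x} → D x → D (fwd x) → 6 ≤ ∣ X ∣
      six-blockers {x} Dx Dfx =
        let p₁ , X₁ , _ , l₁  = behind A Dx
            p₂ , X₂ , e₂ , l₂ = behind⊥ Dx
            p₃ , X₃ , e₃ , l₃ = ahead⊥ Dx
            p₄ , X₄ , e₄ , l₄ = behind⊥ Dfx
            p₅ , X₅ , e₅ , l₅ = ahead⊥ Dfx
            p₆ , X₆ , _ , l₆  = ahead A Dfx
        in
        length≤∣∣ {S = X} (Linked≺⇒Unique (key A)
            (inj₁ (subst (along p₁ <_) (sym e₂) l₁) ∷ inj₂ (trans e₂ (sym e₃) , <-trans l₂ l₃) ∷
             inj₁ (subst₂ _<_ (sym e₃) (trans (sym (along-fwd Dx)) (sym e₄)) (n<1+n (along x))) ∷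
             inj₂ (trans e₄ (sym e₅) , <-trans l₄ l₅) ∷ inj₁ (subst (_< along p₆) (sym e₅) l₆) ∷ [-]))
          (X₁ ∷ X₂ ∷ X₃ ∷ X₄ ∷ X₅ ∷ X₆ ∷ [])

      six-blockers-bwd : ∀ {x} → D x → D (bwd x) → 6 ≤ ∣ X ∣
      six-blockers-bwd {x} Dx Dbx = six-blockers Dbx (subst D (sym (fwd-bwd x)) Dx)

    module HV = Frame horizontal vertical (λ _ → refl) (λ _ → refl)
    module VH = Frame vertical horizontal (λ _ → refl) (λ _ → refl)

    4≤∣X∣ : 4 ≤ ∣ X ∣
    4≤∣X∣ = HV.four-blockers

    6≤∣X∣ : MinDegGe Γ S 1 → 6 ≤ ∣ X ∣
    6≤∣X∣ δ =
      let y , wy , Sy = neighbour {S = S} {v = w} (δ w (not-true⁺ Xw)) in six (adj⇒Move {w} {y} wy) (step Dw wy Sy)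
      where
      six : ∀ {y} → Move w y → D y → 6 ≤ ∣ X ∣
      six to-right = HV.six-blockers Dw
      six to-left  = HV.six-blockers-bwd Dw
      six to-down  = VH.six-blockers Dw
      six to-up    = VH.six-blockers-bwd Dw

    -- Every vertex of D has two distinct free neighbours.
    TwoFreeNeighbours : Set
    TwoFreeNeighbours = ∀ {x} → D x → ∀ o → ¬ (∀ {z} → Move x z → X z ≡ false → z ≡ o)

    two-free-neighbours : MinDegGe Γ S 2 → TwoFreeNeighbours
    two-free-neighbours δ {x} Dx o only-o =
      let z , xz , Sz , z≢o = neighbour-avoiding {S = S} {v = x} _≟V_ (δ x (Reach-end Dx)) o
      in  z≢o (only-o (adj⇒Move {x} {z} xz) (not-true⁻ {X z} Sz))

    InRow : ℕ → Set
    InRow t = ∃[ x ] D x × ρv x ≡ t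

    TopRow BottomRow : ℕ → Set
    TopRow t    = ∀ {j} → j < t → ¬ InRow j
    BottomRow b = ∀ {j} → b < j → ¬ InRow j

    up-blocked : ∀ {t x} → TopRow t → D x → ρv x ≡ t → X (up x) ≡ true
    up-blocked {x = x} top Dx refl with X (up x) in e
    ... | true  = refl
    ... | false = ⊥-elim (top (≤-reflexive (Axis.along-bwd vertical Dx)) (up x , D-step Dx to-up e , refl))

    down-blocked : ∀ {b x} → BottomRow b → D x → ρv x ≡ b → X (down x) ≡ true
    down-blocked {x = x} bottom Dx refl with X (down x) in e
    ... | true  = refl
    ... | false = ⊥-elim (bottom (≤-reflexive (sym (Axis.along-fwd vertical Dx))) (down x , D-step Dx to-down e , refl))

    HorizontalPair : V → Set
    HorizontalPair x = ∃[ q ] D q × D (right q) × ρv q ≡ ρv x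

    module _ (two-free : TwoFreeNeighbours) where

      horizontal-pair : ∀ {x} → D x → ∀ o → (∀ {z} → Move x z → X z ≡ false → z ≢ right x → z ≢ left x → z ≡ o) →
                        HorizontalPair x
      horizontal-pair {x} Dx o vertical≡o with X (left x) in eL | X (right x) in eR
      ... | false | _     = left x , D-step Dx to-left eL , subst D (sym (right-left x)) Dx , refl
      ... | true  | false = x , Dx , D-step Dx to-right eR , refl
      ... | true  | true  = ⊥-elim (two-free Dx o λ m Xz →
        vertical≡o m Xz (λ { refl → true≢false eR Xz }) (λ { refl → true≢false eL Xz }))

      top-pair : ∀ {t x} → TopRow t → D x → ρv x ≡ t → HorizontalPair x
      top-pair {x = x} top Dx x-row = horizontal-pair Dx (down x) λ
        { to-right _  ≢right _ → ⊥-elim (≢right refl)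
        ; to-left  _  _ ≢left  → ⊥-elim (≢left refl)
        ; to-down  _  _ _      → refl
        ; to-up    Xz _ _      → ⊥-elim (true≢false (up-blocked top Dx x-row) Xz) }

      bottom-pair : ∀ {b x} → BottomRow b → D x → ρv x ≡ b → HorizontalPair x
      bottom-pair {x = x} bottom Dx x-row = horizontal-pair Dx (up x) λ
        { to-right _  ≢right _ → ⊥-elim (≢right refl)
        ; to-left  _  _ ≢left  → ⊥-elim (≢left refl)
        ; to-down  Xz _ _      → ⊥-elim (true≢false (down-blocked bottom Dx x-row) Xz)
        ; to-up    _  _ _      → refl }

      -- The leftmost vertex of a one-row component has at most one free neighbour.
      single-row : ∀ {t} → TopRow t → BottomRow t → InRow t → ⊥
      single-row top bottom (x , Dx , x-row) =
        let y , Dy , X-left-y , y-row , _ = last-bwd horizontal Dx in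
        two-free Dy (right y) λ
          { to-right _  → refl
          ; to-left  Xz → ⊥-elim (true≢false X-left-y Xz)
          ; to-down  Xz → ⊥-elim (true≢false (down-blocked bottom Dy (trans y-row x-row)) Xz)
          ; to-up    Xz → ⊥-elim (true≢false (up-blocked top Dy (trans y-row x-row)) Xz) }

      -- By rows: above the top pair, the two blockers of row t, the two blockers of row b, below the bottom pair.
      eight-blockers : ∀ {t b} → TopRow t → BottomRow b → t < b → InRow t → InRow b → 8 ≤ ∣ X ∣
      eight-blockers top bottom t<b (p , Dp , refl) (p′ , Dp′ , refl) =
        let q  , Dq  , Drq  , q-row  = top-pair top Dp refl
            q′ , Dq′ , Drq′ , q′-row = bottom-pair bottom Dp′ refl
            B₁ , XB₁ , eB₁ , lB₁ = behind horizontal Dp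
            B₂ , XB₂ , eB₂ , lB₂ = ahead horizontal Dp
            E₁ , XE₁ , eE₁ , lE₁ = behind horizontal Dp′
            E₂ , XE₂ , eE₂ , lE₂ = ahead horizontal Dp′
        in
        length≤∣∣ {S = X} (Linked≺⇒Unique (key vertical)
            (inj₂ (refl , ≤-reflexive (sym (Axis.along-fwd horizontal Dq))) ∷
             inj₁ (≤-reflexive (trans (Axis.along-bwd vertical Dq) (trans q-row (sym eB₁)))) ∷
             inj₂ (trans eB₁ (sym eB₂) , <-trans lB₁ lB₂) ∷
             inj₁ (subst₂ _<_ (sym eB₂) (sym eE₁) t<b) ∷
             inj₂ (trans eE₁ (sym eE₂) , <-trans lE₁ lE₂) ∷
             inj₁ (subst₂ _<_ (trans q′-row (sym eE₂)) (sym (Axis.along-fwd vertical Dq′)) (n<1+n _)) ∷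
             inj₂ (refl , ≤-reflexive (sym (Axis.along-fwd horizontal Dq′))) ∷ [-]))
          (up-blocked top Dq q-row ∷ up-blocked top Drq q-row ∷ XB₁ ∷ XB₂ ∷ XE₁ ∷ XE₂ ∷
           down-blocked bottom Dq′ q′-row ∷ down-blocked bottom Drq′ q′-row ∷ [])

    -- The top and bottom rows of D exist only classically, which is harmless as 8 ≤ ∣ X ∣ is decidable.
    8≤∣X∣ : MinDegGe Γ S 2 → 8 ≤ ∣ X ∣
    8≤∣X∣ δ = decidable-stable (8 ≤? ∣ X ∣) λ 8≰∣X∣ →
      ¬¬-least {P = InRow} (w , Dw , refl) λ (t , row-t , top) →
      ¬¬-greatest {P = InRow} m₁ (λ { (x , Dx , refl) → <⇒≤ (Axis.along<size vertical Dx) }) row-t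
        λ (b , row-b , bottom) →
      case m≤n⇒m<n∨m≡n (≮⇒≥ (λ b<t → top b<t row-b)) of λ
        { (inj₁ t<b)  → 8≰∣X∣ (eight-blockers two-free top bottom t<b row-t row-b)
        ; (inj₂ refl) → single-row two-free top bottom row-t }
      where two-free = two-free-neighbours δ

  free-line : ∀ {X : VSet Γ} {k j} (line : Fin k → Fin j → V) → (∀ {r r′ a a′} → line r a ≡ line r′ a′ → r ≡ r′) →
              ∣ X ∣ < k → ∃[ r ] ∀ a → X (line r a) ≡ false
  free-line {X} {k} {j} line line-injective small with Fin.all? (λ r → Fin.any? (λ a → X (line r a) Bool.≟ true))
  ... | yes hit = ⊥-elim (≤⇒≯ (subst (_≤ ∣ X ∣) (length-tabulate point) points⊆X) small)
    where
    point = λ r → line r (proj₁ (hit r))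
    points⊆X = length≤∣∣ {S = X} (Unique.tabulate⁺ line-injective) (All.tabulate⁺ (proj₂ ∘ hit))
  ... | no ¬hit =
    let r , r-missed = Fin.¬∀⟶∃¬ _ _ (λ r → Fin.any? (λ a → X (line r a) Bool.≟ true)) ¬hit
    in  r , λ a → ¬-not (λ Xa → r-missed (a , Xa))

  -- One of the two vertices separated by X misses the component of the free column and row; this is argued
  -- by contradiction, k ≤ ∣ X ∣ being decidable.
  lower-bound-via-core : ∀ {X : VSet Γ} {k} → k ≤ suc m₁ → m₁ ≤ n₁ → Disconnected Γ X →
    (∀ {c₀ r₀} → (∀ b → X (c₀ , b) ≡ false) → (∀ a → X (a , r₀) ≡ false) →
       ∀ {w} → X w ≡ false → ¬ Reach Γ (compl Γ X) w (c₀ , r₀) → k ≤ ∣ X ∣) →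
    k ≤ ∣ X ∣
  lower-bound-via-core {X} {k} k≤m m≤n (u , v , Xu , Xv , u↛v) core = decidable-stable (k ≤? ∣ X ∣) λ k≰∣X∣ →
    let small = <-≤-trans (≰⇒> k≰∣X∣) k≤m
        c₀ , column-free = free-line {X} (λ c b → c , b) (cong proj₁) (≤-trans small (s≤s m≤n))
        r₀ , row-free    = free-line {X} (λ r a → a , r) (cong proj₂) small
    in  k≰∣X∣ (core {c₀} {r₀} column-free row-free {u} Xu λ u→hub →
        k≰∣X∣ (core {c₀} {r₀} column-free row-free {v} Xv λ v→hub →
        u↛v (Reach-trans u→hub (Reach-sym adj-sym v→hub))))

  module _ (7≤m₁ : 7 ≤ m₁) (m₁≤n₁ : m₁ ≤ n₁) where

    private
      3≤m₁ = ≤-trans (m≤m+n 3 4) 7≤m₁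
      3≤n₁ = ≤-trans 3≤m₁ m₁≤n₁
      2≤m₁ = ≤-trans (m≤m+n 2 1) 3≤m₁
      2≤n₁ = ≤-trans (m≤m+n 2 1) 3≤n₁
      open Distinct 2≤n₁ 2≤m₁

    gc₀-lower : ∀ X C t → GoodNeighborCut Γ 0 X → Component Γ X C → CompVal Γ 0 C t → 5 ≤ ∣ X ∣ + t
    gc₀-lower X C t cut comp val = +-mono-≤
      (lower-bound-via-core (≤-trans (m≤m+n 4 4) (s≤s 7≤m₁)) m₁≤n₁ (proj₁ cut) (Core.4≤∣X∣ X))
      (CompVal≥ orderBound₀ cut comp val)

    gc₁-lower : ∀ X C t → GoodNeighborCut Γ 1 X → Component Γ X C → CompVal Γ 1 C t → 8 ≤ ∣ X ∣ + t
    gc₁-lower X C t cut comp val = +-mono-≤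
      (lower-bound-via-core (≤-trans (m≤m+n 6 2) (s≤s 7≤m₁)) m₁≤n₁ (proj₁ cut)
        (λ column-free row-free Xw w↛hub → Core.6≤∣X∣ X column-free row-free Xw w↛hub (proj₂ cut)))
      (CompVal≥ (orderBound₁ loopless) cut comp val)

    gc₂-lower : ∀ X C t → GoodNeighborCut Γ 2 X → Component Γ X C → CompVal Γ 2 C t → 12 ≤ ∣ X ∣ + t
    gc₂-lower X C t cut comp val = +-mono-≤
      (lower-bound-via-core (s≤s 7≤m₁) m₁≤n₁ (proj₁ cut)
        (λ column-free row-free Xw w↛hub → Core.8≤∣X∣ X column-free row-free Xw w↛hub (proj₂ cut)))
      (CompVal≥ (orderBound₂-torus 3≤n₁ 3≤m₁) cut comp val)

data Coord (k : ℕ) : Fin (6 + k) → Set where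
  near : (i : Fin 6) → Coord k (i ↑ˡ k)
  far  : (j : Fin k) → Coord k (6 ↑ʳ j)

coord : ∀ {k} (a : Fin (6 + k)) → Coord k a
coord {k} a = subst (Coord k) (join-splitAt 6 k a) (from-sum (splitAt 6 a))
  where
  from-sum : (s : Fin 6 ⊎ Fin k) → Coord k (join 6 k s)
  from-sum (inj₁ i) = near i
  from-sum (inj₂ j) = far j

module UpperBounds (n′ m′ : ℕ) where

  open Torus (7 + n′) (7 + m′)
  open Distinct (s≤s (s≤s z≤n)) (s≤s (s≤s z≤n))
  open import Data.List.Membership.DecPropositional _≟V_ using (_∈?_)

  record Neighbours (x : V) : Set where
    field
      list     : List V
      unique   : Unique list
      adjacent : All (λ y → adj x y ≡ true) list

  all-moves vertical horizontal left-and-vertical : ∀ x → Neighbours x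
  all-moves x         = record { list = moves x ; unique = moves-unique x ; adjacent = moves-adj x }
  vertical x          = record { list = down x ∷ up x ∷ [] ; unique = (down≢up x ∷ []) ∷ [] ∷ []
                               ; adjacent = Move⇒adj {x} to-down ∷ Move⇒adj {x} to-up ∷ [] }
  horizontal x        = record { list = right x ∷ left x ∷ [] ; unique = (right≢left x ∷ []) ∷ [] ∷ []
                               ; adjacent = Move⇒adj {x} to-right ∷ Move⇒adj {x} to-left ∷ [] }
  left-and-vertical x = record { list = left x ∷ down x ∷ up x ∷ []
                               ; unique = (left≢vertical x ∷ left≢vertical x ∷ []) ∷ (down≢up x ∷ []) ∷ [] ∷ []
                               ; adjacent = Move⇒adj {x} to-left ∷ Move⇒adj {x} to-down ∷ Move⇒adj {x} to-up ∷ [] }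

  enough : VSet Γ → ℕ → (x : V) → Neighbours x → Bool
  enough X g x ns = X x ∨ (g ≤ᵇ length (filterᵇ (compl Γ X) (Neighbours.list ns)))

  enough⇒degIn : ∀ {X g x} (ns : Neighbours x) → T (enough X g x ns) → compl Γ X x ≡ true → g ≤ degIn Γ (compl Γ X) x
  enough⇒degIn {X} {g} {x} ns ok X̄x = ≤-trans (≤ᵇ⇒≤ g _ (∨-resolve ok (not-true⁻ X̄x)))
    (length-filterᵇ≤degIn {S = compl Γ X} {v = x} (Neighbours.unique ns) (Neighbours.adjacent ns))

  near-column : Fin 6 → Fin (suc (7 + n′))
  near-column i = i ↑ˡ (2 + n′)

  near-row : Fin 6 → Fin (suc (7 + m′))
  near-row j = j ↑ˡ (2 + m′)

  -- For X inside [0,6)²: vertices there are checked by computation, every other one has a free row or column.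
  MinDegGe-box : ∀ (X : VSet Γ) g →
    {∀ j b → T (enough X g (6 ↑ʳ j , b) (vertical _))} →
    {∀ j → True (all? λ i → T? (enough X g (near-column i , 6 ↑ʳ j) (horizontal _)))} →
    {True (all? λ i → all? λ j → T? (enough X g (near-column i , near-row j) (all-moves _)))} →
    MinDegGe Γ (compl Γ X) g
  MinDegGe-box X g {far-column} {far-row} {box} (a , b) = by-coord (coord a) (coord b)
    where
    by-coord : ∀ {a b} → Coord _ a → Coord _ b → compl Γ X (a , b) ≡ true → g ≤ degIn Γ (compl Γ X) (a , b)
    by-coord (far j)  _        = enough⇒degIn {X} {g} (vertical _) (far-column j _)
    by-coord (near i) (far j)  = enough⇒degIn {X} {g} (horizontal _) (toWitness (far-row j) i)
    by-coord (near i) (near j) = enough⇒degIn {X} {g} (all-moves _) (toWitness box i j)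

  -- For X inside the columns 0…5: these are checked by computation, any other vertex has three free neighbours.
  MinDegGe-columns : ∀ (X : VSet Γ) g →
    {∀ j b → T (enough X g (6 ↑ʳ j , b) (left-and-vertical _))} →
    {∀ b → True (all? λ i → T? (enough X g (near-column i , b) (all-moves _)))} →
    MinDegGe Γ (compl Γ X) g
  MinDegGe-columns X g {far-column} {near-columns} (a , b) = by-coord (coord a)
    where
    by-coord : ∀ {a} → Coord _ a → compl Γ X (a , b) ≡ true → g ≤ degIn Γ (compl Γ X) (a , b)
    by-coord (far j)  = enough⇒degIn {X} {g} (left-and-vertical _) (far-column j b)
    by-coord (near i) = enough⇒degIn {X} {g} (all-moves _) (toWitness (near-columns b) i)

  Closed-by-moves : ∀ {X C : VSet Γ} → (∀ {u} → C u ≡ true → All (λ z → T (X z ∨ C z)) (moves u)) → Closed X C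
  Closed-by-moves {X} {C} check u v Cu uv Xv =
    Equivalence.to T-≡ (∨-resolve (All.lookup (check Cu) (Move⇒∈moves (adj⇒Move {u} {v} uv))) Xv)

  member : List V → VSet Γ
  member xs x = ⌊ x ∈? xs ⌋

  member⁺ : ∀ {xs x} → x ∈ xs → member xs x ≡ true
  member⁺ {xs} {x} = ⌊⌋-complete (x ∈? xs)

  member⁻ : ∀ {xs x} → member xs x ≡ true → x ∈ xs
  member⁻ {xs} {x} = ⌊⌋-sound (x ∈? xs)

  ∣member∣ : ∀ {xs} → Unique xs → ∣ member xs ∣ ≡ length xs
  ∣member∣ {xs} unique =
    ≤-antisym (∣∣≤length {S = member xs} (λ _ → member⁻)) (length≤∣∣ {S = member xs} unique (All.tabulate member⁺))

  unique? : ∀ xs → Dec (Unique xs)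
  unique? = AllPairs.allPairs? (λ x y → ¬? (x ≟V y))

  separated? : ∀ Xs Cs c → Dec (member Xs c ≡ false × All (λ z → T (member Xs z ∨ member Cs z)) (moves c))
  separated? Xs Cs c = (member Xs c Bool.≟ false) ×-dec All.all? (λ z → T? (member Xs z ∨ member Cs z)) (moves c)

  list-cut : ∀ g {k} (Xs Cs : List V) {h z} → {True (unique? Xs)} → {True (unique? Cs)} →
    MinDegGe Γ (compl Γ (member Xs)) g → h ∈ Cs → (∀ {v} → v ∈ Cs → Reach Γ (compl Γ (member Xs)) h v) →
    {True (All.all? (separated? Xs Cs) Cs)} → member Xs z ≡ false → member Cs z ≡ false →
    OrderBound g k → length Cs < k + k →
    ∃[ X ] GoodNeighborCut Γ g X × Attains Γ g X (length Xs + length Cs)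
  list-cut g Xs Cs {h} {_} {uXs} {uCs} δ h∈Cs connected {checks} Xz Cz bound small =
    member Xs , subst (λ k → GoodNeighborCut Γ g (member Xs) × Attains Γ g (member Xs) k)
                      (cong₂ _+_ (∣member∣ (toWitness uXs)) (∣member∣ (toWitness uCs)))
                      (closed-part⇒cut adj-sym δ (member⁺ h∈Cs) (λ _ → proj₁ ∘ check) (connected ∘ member⁻)
                        (Closed-by-moves (proj₂ ∘ check)) Xz Cz
                        (small⇒¬Splittable bound (subst (_< _) (sym (∣member∣ (toWitness uCs))) small)))
    where
    check : ∀ {c} → member Cs c ≡ true → member Xs c ≡ false × All (λ z → T (member Xs z ∨ member Cs z)) (moves c)
    check = All.lookup (toWitness checks) ∘ member⁻

  centre : V
  centre = # 2 , # 2

  X₀ C₀ X₁ C₁ X₂ C₂ : List V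
  X₀ = (# 1 , # 2) ∷ (# 3 , # 2) ∷ (# 2 , # 1) ∷ (# 2 , # 3) ∷ []
  C₀ = centre ∷ []
  X₁ = (# 1 , # 2) ∷ (# 4 , # 2) ∷ (# 2 , # 1) ∷ (# 3 , # 1) ∷ (# 2 , # 3) ∷ (# 3 , # 3) ∷ []
  C₁ = centre ∷ (# 3 , # 2) ∷ []
  X₂ = (# 1 , # 2) ∷ (# 1 , # 3) ∷ (# 4 , # 2) ∷ (# 4 , # 3) ∷ (# 2 , # 1) ∷ (# 3 , # 1) ∷ (# 2 , # 4) ∷ (# 3 , # 4) ∷ []
  C₂ = centre ∷ (# 3 , # 2) ∷ (# 2 , # 3) ∷ (# 3 , # 3) ∷ []

  gc₀-upper : ∃[ X ] GoodNeighborCut Γ 0 X × Attains Γ 0 X 5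
  gc₀-upper = list-cut 0 X₀ C₀ {z = zero , zero} (λ _ _ → z≤n) (here refl) (λ { (here refl) → here refl })
    refl refl orderBound₀ ≤-refl

  gc₁-upper : ∃[ X ] GoodNeighborCut Γ 1 X × Attains Γ 1 X 8
  gc₁-upper = list-cut 1 X₁ C₁ {z = zero , zero} (MinDegGe-box (member X₁) 1) (here refl)
    (λ { (here refl) → here refl ; (there (here refl)) → step (here refl) (Move⇒adj {centre} to-right) refl })
    refl refl (orderBound₁ loopless) (n≤1+n 3)

  gc₂-upper : ∃[ X ] GoodNeighborCut Γ 2 X × Attains Γ 2 X 12
  gc₂-upper = list-cut 2 X₂ C₂ {z = zero , zero} (MinDegGe-box (member X₂) 2) (here refl)
    (λ { (here refl)                         → here refl
       ; (there (here refl))                 → step (here refl) (Move⇒adj {centre} to-right) refl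
       ; (there (there (here refl)))         → step (here refl) (Move⇒adj {centre} to-down) refl
       ; (there (there (there (here refl)))) →
           step (step {w = right centre} (here refl) (Move⇒adj {centre} to-right) refl)
                (Move⇒adj {right centre} to-down) refl })
    refl refl (orderBound₂-torus (s≤s (s≤s (s≤s z≤n))) (s≤s (s≤s (s≤s z≤n)))) (m≤m+n 5 3)

  two-columns : Fin (suc (7 + n′)) → Fin (suc (7 + n′)) → VSet Γ
  two-columns c c′ (a , _) = ⌊ a Fin.≟ c ⌋ ∨ ⌊ a Fin.≟ c′ ⌋

  two-columns⁻ : ∀ {c c′ a b} → two-columns c c′ (a , b) ≡ true → a ≡ c ⊎ a ≡ c′
  two-columns⁻ {c} {c′} {a} e with ∨-true⁻ e
  ... | inj₁ e₁ = inj₁ (⌊⌋-sound (a Fin.≟ c) e₁)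
  ... | inj₂ e₂ = inj₂ (⌊⌋-sound (a Fin.≟ c′) e₂)

  ∣two-columns∣ : ∀ c c′ → ∣ two-columns c c′ ∣ ≤ suc (7 + m′) + suc (7 + m′)
  ∣two-columns∣ c c′ = ≤-trans (∣∣≤length {S = two-columns c c′} covered)
    (≤-reflexive (trans (length-++ (column c) {column c′}) (cong₂ _+_ (length-column c) (length-column c′))))
    where
    column : Fin (suc (7 + n′)) → List V
    column a = tabulate (a ,_)
    length-column : ∀ a → length (column a) ≡ suc (7 + m′)
    length-column a = length-tabulate (a ,_)
    covered : ∀ x → two-columns c c′ x ≡ true → x ∈ column c ++ column c′
    covered (a , b) e with two-columns⁻ {c} {c′} {a} {b} e
    ... | inj₁ refl = ∈-++⁺ˡ (∈-tabulate⁺ {n = suc (7 + m′)} {f = c ,_} b)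
    ... | inj₂ refl = ∈-++⁺ʳ (column c) (∈-tabulate⁺ {n = suc (7 + m′)} {f = c′ ,_} b)

  X₃ C₃ : VSet Γ
  X₃ = two-columns (# 1) (# 4)
  C₃ = two-columns (# 2) (# 3)

  C₃-connected : ∀ {S : VSet Γ} → (∀ b → S (# 2 , b) ≡ true) → (∀ b → S (# 3 , b) ≡ true) →
                 ∀ {v} → C₃ v ≡ true → Reach Γ S (# 2 , zero) v
  C₃-connected S₂ S₃ {a , b} e with two-columns⁻ {# 2} {# 3} {a} {b} e
  ... | inj₁ refl = Reach-along-column S₂ zero b
  ... | inj₂ refl =
    Reach-trans (step (here (S₂ zero)) (Move⇒adj {# 2 , zero} to-right) (S₃ zero)) (Reach-along-column S₃ zero b)

  C₃-sparse : ∀ v → C₃ v ≡ true → degIn Γ C₃ v ≤ 3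
  C₃-sparse (a , b) e with two-columns⁻ {# 2} {# 3} {a} {b} e
  ... | inj₁ refl = ≤-reflexive (degIn≡free-moves C₃ (# 2 , b))
  ... | inj₂ refl = ≤-reflexive (degIn≡free-moves C₃ (# 3 , b))

  C₃-closed : Closed X₃ C₃
  C₃-closed = Closed-by-moves {X₃} {C₃} λ { {a , b} e → neighbours (two-columns⁻ {# 2} {# 3} {a} {b} e) }
    where
    neighbours : ∀ {a b} → a ≡ # 2 ⊎ a ≡ # 3 → All (λ z → T (X₃ z ∨ C₃ z)) (moves (a , b))
    neighbours (inj₁ refl) = _ ∷ _ ∷ _ ∷ _ ∷ []
    neighbours (inj₂ refl) = _ ∷ _ ∷ _ ∷ _ ∷ []

  C₃∩X₃=∅ : ∀ v → C₃ v ≡ true → X₃ v ≡ false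
  C₃∩X₃=∅ (a , b) e with two-columns⁻ {# 2} {# 3} {a} {b} e
  ... | inj₁ refl = refl
  ... | inj₂ refl = refl

  C₃-unsplittable : ¬ Splittable Γ 3 C₃
  C₃-unsplittable = ¬Splittable-sparse C₃-sparse λ Cu Cv → Reach-trans (Reach-sym adj-sym (inside Cu)) (inside Cv)
    where inside = C₃-connected {S = C₃} (λ _ → refl) (λ _ → refl)

  C₃-cut : GoodNeighborCut Γ 3 X₃ × Attains Γ 3 X₃ (∣ X₃ ∣ + ∣ C₃ ∣)
  C₃-cut = closed-part⇒cut {z = zero , zero} adj-sym (MinDegGe-columns X₃ 3) refl C₃∩X₃=∅
    (C₃-connected (λ _ → refl) (λ _ → refl)) C₃-closed refl refl C₃-unsplittable

  ∣X₃∣+∣C₃∣≤4m : ∣ X₃ ∣ + ∣ C₃ ∣ ≤ 4 * suc (7 + m′)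
  ∣X₃∣+∣C₃∣≤4m = ≤-trans (+-mono-≤ (∣two-columns∣ (# 1) (# 4)) (∣two-columns∣ (# 2) (# 3))) (≤-reflexive 2m+2m≡4m)
    where
    m = suc (7 + m′)
    2m+2m≡4m : (m + m) + (m + m) ≡ 4 * m
    2m+2m≡4m = trans (+-assoc m m (m + m)) (cong (λ k → m + (m + (m + k))) (sym (+-identityʳ m)))

  gc₃-upper : GcLe Γ 3 (4 * suc (7 + m′))
  gc₃-upper = X₃ , _ , proj₁ C₃-cut , proj₂ C₃-cut , ∣X₃∣+∣C₃∣≤4m

torus-gc : ∀ n′ m′ → m′ ≤ n′ →
  (GcEq (torus (8 + n′) (8 + m′)) 0 5 × GcEq (torus (8 + n′) (8 + m′)) 1 8 × GcEq (torus (8 + n′) (8 + m′)) 2 12)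
  × GcLe (torus (8 + n′) (8 + m′)) 3 (4 * (8 + m′))
torus-gc n′ m′ m′≤n′ =
  ((gc₀-upper , gc₀-lower 7≤m₁ m₁≤n₁) , (gc₁-upper , gc₁-lower 7≤m₁ m₁≤n₁) , (gc₂-upper , gc₂-lower 7≤m₁ m₁≤n₁)) , gc₃-upper
  where
  open UpperBounds n′ m′
  open LowerBounds (7 + n′) (7 + m′)
  7≤m₁ = m≤m+n 7 m′
  m₁≤n₁ = +-monoʳ-≤ 7 m′≤n′

proposition6p2 : (n m : ℕ) → 8 ≤ m → m ≤ n →
    (GcEq (torus n m) 0 5 × GcEq (torus n m) 1 8 × GcEq (torus n m) 2 12)
    × GcLe (torus n m) 3 (4 * m)
proposition6p2 n m 8≤m m≤n with m′ , refl ← m≤n⇒∃[o]m+o≡n 8≤m | o , refl ← m≤n⇒∃[o]m+o≡n m≤n =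
  torus-gc (m′ + o) m′ (m≤m+n m′ o)
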